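{- Let $NC$ be an initial neuronal circuit satisfying $\mathit{PositiveLoop}(NC)$, with neurons $N_0,N_1$ (identifiers $0,1$). Assume $w_{N_0}(2)\ge\tau_{N_0}$, $w_{N_0}(1)\ge\tau_{N_0}$ and $w_{N_1}(0)\ge\tau_{N_1}$. Let $\mathit{inp}$ be an external input sequence (a list of booleans) all of whose entries are $0$. Then $output_{NC}(N_0,\mathit{inp})=\mathit{repeat}(0,|\mathit{inp}|+1)$ and $output_{NC}(N_1,\mathit{inp})=\mathit{repeat}(0,|\mathit{inp}|+1)$.
   Context: Booleans are identified with $0$ (false) and $1$ (true). A neuron $N$ consists of an identifier $id_N\in\mathbb{N}$, a weight function $w_N:\mathbb{N}\to\mathbb{Q}$ with $-1\le w_N(x)\le 1$ for all $x$ and $w_N(id_N)=0$, a leak factor $lk_N\in\mathbb{Q}$ with $0\le lk_N\le 1$, a threshold $\tau_N\in\mathbb{Q}$ with $\tau_N>0$, an output list $Output(N)$ of booleans (most recent first) and a current potential $CurPot(N)\in\mathbb{Q}$, subject to: $(\tau_N\le CurPot(N))$ equals the head of $Output(N)$ (the head of an empty list being $0$). An input function is a map $i:\mathbb{N}\to\{0,1\}$; $potential(w,i,len)=\sum_{0\le k<len,\ i(k)=1} w(k)$. The one-step update of $N$ with input function $i$ in an environment of $len$ neurons keeps $id,w,lk,\tau$, sets the new potential $p=potential(w_N,i,len)$ if $\tau_N\le CurPot(N)$ and $p=potential(w_N,i,len)+lk_N\cdot CurPot(N)$ otherwise, and sets the new output list to $(\tau_N\le p)::Output(N)$. A neuron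 is initial if its output list is $[0]$ and its current potential is $0$. A neuronal circuit $NC$ consists of a time $t_{NC}$, a list $ln_{NC}$ of neurons with pairwise distinct identifiers all $<|ln_{NC}|$ and all output lists of length $t_{NC}+1$, and a number $si_{NC}$ of external sources, with identifiers $|ln_{NC}|,\dots,L-1$, $L=|ln_{NC}|+si_{NC}$. One step of $NC$ on an external input function $e$ replaces each neuron $N$ by its one-step update in an environment of $L$ neurons with input function $x\mapsto$ (head of the output list, before the step, of the circuit neuron with identifier $x$ if $x<|ln_{NC}|$; $e(x)$ otherwise), and increments the time. A list of external inputs (most recent first) is processed from its last element to its first. $output_{NC}(N,\mathit{inp})$ is the output list of the neuron with identifier $id_N$ after processing $\mathit{inp}$. $NC$ is initial if all its neurons are initial. When $si_{NC}=1$, an external input sequence is a list of booleans, each giving the value supplied by the unique external source at that step. $\mathit{PositiveLoop}(NC)$ means: $si_{NC}=1$, $|ln_{NC}|=2$, the neuron with identifier $0$ has $w(1)>0$ and $w(2)>0$, and the neuron with identifier $1$ has $w(0)>0$ and $w(2)=0$ (so the external source has identifier $2$). $\mathit{repeat}(v,k)$ is the list of $k$ copies of $v$. -}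

module Defs where

open import Data.Bool using (Bool; true; false; if_then_else_)
open import Data.Nat as ℕ using (ℕ; zero; suc)
open import Data.Nat.Properties as ℕP using ()
open import Data.Rational as ℚ using (ℚ; 0ℚ; 1ℚ; -_; _≤_; _<_; _≤ᵇ_; _+_; _*_)
open import Data.List using (List; []; _∷_; length; map)
open import Data.List.Relation.Unary.All using (All)
open import Data.List.Relation.Unary.AllPairs using (AllPairs)
open import Data.Maybe using (Maybe; just; nothing)
open import Data.Product using (_×_; _,_)
open import Relation.Binary.PropositionalEquality using (_≡_; _≢_; refl)
open import Relation.Nullary using (does)

headB : List Bool → Bool
headB []      = false
headB (b ∷ _) = b

record Neuron : Set where
  field
    id      : ℕ
    w       : ℕ → ℚ
    w-range : ∀ x → (- 1ℚ ≤ w x) × (w x ≤ 1ℚ)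
    w-self  : w id ≡ 0ℚ
    lk      : ℚ
    lk-range : (0ℚ ≤ lk) × (lk ≤ 1ℚ)
    τ       : ℚ
    τ-pos   : 0ℚ < τ
    Output  : List Bool
    CurPot  : ℚ
    inv     : (τ ≤ᵇ CurPot) ≡ headB Output
open Neuron public

potential : (ℕ → ℚ) → (ℕ → Bool) → ℕ → ℚ
potential w i zero    = 0ℚ
potential w i (suc k) = potential w i k + (if i k then w k else 0ℚ)

newPot : Neuron → (ℕ → Bool) → ℕ → ℚ
newPot N i len =
  if τ N ≤ᵇ CurPot N
  then potential (w N) i len
  else potential (w N) i len + lk N * CurPot N

update : Neuron → (ℕ → Bool) → ℕ → Neuron
update N i len = record
  { id = id N ; w = w N ; w-range = w-range N ; w-self = w-self N
  ; lk = lk N ; lk-range = lk-range N ; τ = τ N ; τ-pos = τ-pos N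
  ; Output = (τ N ≤ᵇ newPot N i len) ∷ Output N
  ; CurPot = newPot N i len
  ; inv = refl }

initialNeuron : Neuron → Set
initialNeuron N = (Output N ≡ false ∷ []) × (CurPot N ≡ 0ℚ)

record Circuit : Set where
  field
    time : ℕ
    ln   : List Neuron
    si   : ℕ
    ids-distinct : AllPairs (λ M N → id M ≢ id N) ln
    ids-bound    : All (λ N → id N ℕ.< length ln) ln
    out-length   : All (λ N → length (Output N) ≡ suc time) ln
open Circuit public

findId : ℕ → List Neuron → Maybe Neuron
findId x []       = nothing
findId x (N ∷ ns) = if does (id N ℕ.≟ x) then just N else findId x ns

headOf : Maybe Neuron → Bool
headOf (just N) = headB (Output N)
headOf nothing  = false

stepNs : ℕ → List Neuron → (ℕ → Bool) → List Neuron
stepNs si ns e = map (λ N → update N inputF (length ns ℕ.+ si)) ns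
  where
  inputF : ℕ → Bool
  inputF x = if does (x ℕ.<? length ns) then headOf (findId x ns) else e x

-- process an input list (most recent first) from its last element to its first;
-- for one external source, a boolean b is the external input function x ↦ b
process : ℕ → List Neuron → List Bool → List Neuron
process si ns []       = ns
process si ns (b ∷ bs) = stepNs si (process si ns bs) (λ _ → b)

outputNC : Circuit → Neuron → List Bool → List Bool
outputNC NC N inp with findId (id N) (process (si NC) (ln NC) inp)
... | just M  = Output M
... | nothing = []

initialCircuit : Circuit → Set
initialCircuit NC = All initialNeuron (ln NC)

PositiveLoop : Circuit → Set
PositiveLoop NC =
  (si NC ≡ 1) × (length (ln NC) ≡ 2)
  × (∀ N → findId 0 (ln NC) ≡ just N → (0ℚ < w N 1) × (0ℚ < w N 2))
  × (∀ N → findId 1 (ln NC) ≡ just N → (0ℚ < w N 0) × (w N 2 ≡ 0ℚ))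

repeat : {A : Set} → A → ℕ → List A
repeat v zero    = []
repeat v (suc k) = v ∷ repeat v k

{-# OPTIONS --safe #-}
module Submission where

-- With no external stimulus, an initial circuit never fires: a silent neuron
-- (all outputs 0, potential 0) receives only 0 inputs, so its new potential is
-- 0 + lk · 0 = 0 < τ and it stays silent. By induction on the input list every
-- neuron is silent, whatever the weights, leaks and thresholds.

open import Defs
open import Data.Bool using (Bool; true; false; if_then_else_)
open import Data.Nat as ℕ using (ℕ; zero; suc)
open import Data.Rational using (_≤_; 0ℚ; _≤ᵇ_; _+_)
open import Data.Rational.Properties using (*-zeroʳ)
open import Data.List using (List; []; _∷_; length; map)
open import Data.List.Properties using (map-∘)
open import Data.List.Membership.Propositional using (_∈_)
open import Data.List.Membership.Propositional.Properties using (∈-map⁺)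
open import Data.List.Relation.Unary.All as All using (All; []; _∷_)
open import Data.List.Relation.Unary.All.Properties using (gmap⁺)
open import Data.List.Relation.Unary.Any using (here; there)
open import Data.Maybe using (just; nothing)
open import Data.Product using (_×_; _,_; proj₁)
open import Relation.Binary.PropositionalEquality
  using (_≡_; _≢_; refl; sym; trans; cong; subst)
open import Relation.Nullary using (does; contradiction)
open import Relation.Nullary.Decidable using (dec-true)

-- Silent 0 N unfolds to initialNeuron N.
Silent : ℕ → Neuron → Set
Silent t N = (Output N ≡ repeat false (suc t)) × (CurPot N ≡ 0ℚ)

potential-silent : ∀ w {i} → (∀ x → i x ≡ false) → ∀ len → potential w i len ≡ 0ℚ
potential-silent w i≡false zero      = refl
potential-silent w i≡false (suc len) rewrite i≡false len | potential-silent w i≡false len = refl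

update-silent : ∀ {t N i} len → (∀ x → i x ≡ false) → Silent t N → Silent (suc t) (update N i len)
update-silent {t} {N} {i} len i≡false (out≡ , pot≡) = output≡ , newPot≡
  where
  idle : (τ N ≤ᵇ 0ℚ) ≡ false
  idle = trans (subst (λ p → (τ N ≤ᵇ p) ≡ headB (Output N)) pot≡ (inv N)) (cong headB out≡)

  newPot≡ : newPot N i len ≡ 0ℚ
  newPot≡ rewrite pot≡ | idle | potential-silent (w N) i≡false len = cong (0ℚ +_) (*-zeroʳ (lk N))

  output≡ : (τ N ≤ᵇ newPot N i len) ∷ Output N ≡ repeat false (suc (suc t))
  output≡ rewrite newPot≡ | idle | out≡ = refl

headOf-findId-silent : ∀ {t} x {ns} → All (Silent t) ns → headOf (findId x ns) ≡ false
headOf-findId-silent x {[]}     []               = refl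
headOf-findId-silent x {N ∷ ns} ((out≡ , _) ∷ ss) with does (id N ℕ.≟ x)
... | true  rewrite out≡ = refl
... | false = headOf-findId-silent x ss

stepNs-silent : ∀ {t} si ns → All (Silent t) ns → All (Silent (suc t)) (stepNs si ns (λ _ → false))
stepNs-silent si ns ss = gmap⁺ (λ {N} → update-silent {N = N} (length ns ℕ.+ si) inputs-silent) ss
  where
  -- the input function local to stepNs, spelled out
  inputs-silent : ∀ x → (if does (x ℕ.<? length ns) then headOf (findId x ns) else false) ≡ false
  inputs-silent x with does (x ℕ.<? length ns)
  ... | true  = headOf-findId-silent x ss
  ... | false = refl

process-silent : ∀ si ns {inp} → All (_≡ false) inp → All (Silent 0) ns →
                 All (Silent (length inp)) (process si ns inp)
process-silent si ns []           ss = ss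
process-silent si ns (refl ∷ inp) ss = stepNs-silent si _ (process-silent si ns inp ss)

stepNs-ids : ∀ si ns e → map id (stepNs si ns e) ≡ map id ns
stepNs-ids si ns e = sym (map-∘ ns)

process-ids : ∀ si ns inp → map id (process si ns inp) ≡ map id ns
process-ids si ns []        = refl
process-ids si ns (b ∷ inp) = trans (stepNs-ids si (process si ns inp) (λ _ → b)) (process-ids si ns inp)

findId-∈ : ∀ x ns {M} → findId x ns ≡ just M → M ∈ ns
findId-∈ x (N ∷ ns) found with does (id N ℕ.≟ x)
findId-∈ x (N ∷ ns) refl  | true  = here refl
... | false = there (findId-∈ x ns found)

findId-defined : ∀ {x} ns → x ∈ map id ns → findId x ns ≢ nothing
findId-defined {x} (N ∷ ns) x∈ with does (id N ℕ.≟ x) in decided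
... | true  = λ ()
... | false with x∈
...   | here x≡  = contradiction (trans (sym decided) (dec-true (id N ℕ.≟ x) (sym x≡))) λ ()
...   | there x∈ns = findId-defined ns x∈ns

outputNC-silent : ∀ NC {N} inp → initialCircuit NC → N ∈ ln NC → All (_≡ false) inp →
                  outputNC NC N inp ≡ repeat false (suc (length inp))
outputNC-silent NC {N} inp initial N∈ zeros
  with findId (id N) (process (si NC) (ln NC) inp) in found
... | just M  = proj₁ (All.lookup (process-silent (si NC) (ln NC) zeros initial)
                                  (findId-∈ (id N) (process (si NC) (ln NC) inp) found))
... | nothing = contradiction found (findId-defined (process (si NC) (ln NC) inp) id∈)
  where
  id∈ : id N ∈ map id (process (si NC) (ln NC) inp)
  id∈ = subst (id N ∈_) (sym (process-ids (si NC) (ln NC) inp)) (∈-map⁺ id N∈)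

proposition6p3 : (NC : Circuit) (N0 N1 : Neuron) (inp : List Bool) →
    initialCircuit NC → PositiveLoop NC →
    N0 ∈ ln NC → id N0 ≡ 0 → N1 ∈ ln NC → id N1 ≡ 1 →
    τ N0 ≤ w N0 2 → τ N0 ≤ w N0 1 → τ N1 ≤ w N1 0 →
    All (_≡ false) inp →
    (outputNC NC N0 inp ≡ repeat false (suc (length inp)))
      × (outputNC NC N1 inp ≡ repeat false (suc (length inp)))
proposition6p3 NC N0 N1 inp initial _ N0∈ _ N1∈ _ _ _ _ zeros =
  outputNC-silent NC inp initial N0∈ zeros , outputNC-silent NC inp initial N1∈ zeros
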